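{- Every alternating floorplan of size $n$ is a packed floorplan (of size $(\lfloor (n+1)/2\rfloor,\lceil (n+1)/2\rceil)$).
   Context: For a positive integer $n$, an alternating floorplan of size $n$ is a partition of a rectangle $R$ of width $\lceil (n+1)/2\rceil$ and height $\lfloor (n+1)/2\rfloor$ into $n$ rectangular tiles whose sides have integer lengths, such that the lattice path from the south-west corner to the north-east corner of $R$ that moves alternately one unit step east and one unit step north, starting with east, is contained in the union of the boundaries of the tiles. For positive integers $k,\ell$, a packed floorplan of size $(k,\ell)$ is a partition of a rectangle of height $k$ and width $\ell$ into $k+\ell-1$ rectangular tiles with integer side lengths such that there is no pair of tiles $(t_1,t_2)$ for which, with $(x_1,y_1)$ the bottom-right corner of $t_1$ and $(x_2,y_2)$ the top-left corner of $t_2$ (x-axis pointing right, y-axis pointing up), both $x_1\le x_2$ and $y_1\ge y_2$. -}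

module Defs where

open import Data.Nat using (ℕ; suc; _+_; _∸_; _≤_; _<_; _≥_; ⌊_/2⌋; ⌈_/2⌉)
open import Data.Fin using (Fin)
open import Data.Product using (_×_; ∃; ∃-syntax; Σ-syntax)
open import Data.Sum using (_⊎_)
open import Relation.Binary.PropositionalEquality using (_≡_)
open import Relation.Nullary using (¬_)

-- A tile is an axis-parallel rectangle [x₀,x₁] × [y₀,y₁] with integer corners.
-- The enclosing rectangle R is [0,W] × [0,H].
record Tile : Set where
  constructor tile
  field
    x₀ y₀ x₁ y₁ : ℕ
open Tile public

-- tile t covers the unit cell [a,a+1] × [b,b+1]
Covers : Tile → ℕ → ℕ → Set
Covers t a b = x₀ t ≤ a × a < x₁ t × y₀ t ≤ b × b < y₁ t

IsFloorplan : ℕ → ℕ → (m : ℕ) → (Fin m → Tile) → Set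
IsFloorplan W H m t =
  (∀ i → x₀ (t i) < x₁ (t i) × y₀ (t i) < y₁ (t i) × x₁ (t i) ≤ W × y₁ (t i) ≤ H)
  × (∀ a b → a < W → b < H → ∃[ i ] Covers (t i) a b)
  × (∀ a b (i j : Fin m) → Covers (t i) a b → Covers (t j) a b → i ≡ j)

-- the horizontal unit segment from (a,b) to (a+1,b) lies on the boundary of some tile
OnHSeg : {m : ℕ} → (Fin m → Tile) → ℕ → ℕ → Set
OnHSeg t a b = ∃[ i ] ((y₀ (t i) ≡ b ⊎ y₁ (t i) ≡ b) × x₀ (t i) ≤ a × suc a ≤ x₁ (t i))

-- the vertical unit segment from (a,b) to (a,b+1) lies on the boundary of some tile
OnVSeg : {m : ℕ} → (Fin m → Tile) → ℕ → ℕ → Set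
OnVSeg t a b = ∃[ i ] ((x₀ (t i) ≡ a ⊎ x₁ (t i) ≡ a) × y₀ (t i) ≤ b × suc b ≤ y₁ (t i))

awidth aheight : ℕ → ℕ
awidth n = ⌈ suc n /2⌉
aheight n = ⌊ suc n /2⌋

-- Alternating floorplan of size n: a floorplan of the awidth n × aheight n rectangle
-- into n tiles such that the staircase path E,N,E,N,... from (0,0) lies in the
-- union of tile boundaries: east steps (m,m)→(m+1,m) for m < width,
-- north steps (m+1,m)→(m+1,m+1) for m < height.
IsAlternating : (n : ℕ) → (Fin n → Tile) → Set
IsAlternating n t =
  IsFloorplan (awidth n) (aheight n) n t
  × (∀ m → m < awidth n → OnHSeg t m m)
  × (∀ m → m < aheight n → OnVSeg t (suc m) m)

-- Packed floorplan of size (k , ℓ): height k, width ℓ, k + ℓ - 1 tiles, and no pair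
-- (t₁,t₂) with bottom-right corner (x₁ t₁ , y₀ t₁) of t₁ and top-left corner
-- (x₀ t₂ , y₁ t₂) of t₂ satisfying x₁ t₁ ≤ x₀ t₂ and y₀ t₁ ≥ y₁ t₂.
IsPacked : (k ℓ : ℕ) → (m : ℕ) → (Fin m → Tile) → Set
IsPacked k ℓ m t =
  IsFloorplan ℓ k m t
  × m ≡ k + ℓ ∸ 1
  × ¬ (Σ[ i ∈ Fin m ] Σ[ j ∈ Fin m ] (x₁ (t i) ≤ x₀ (t j) × y₀ (t i) ≥ y₁ (t j)))

-- Number the cells along the staircase path: cell k is (⌈k/2⌉, ⌊k/2⌋), for k < n.
-- Consecutive staircase cells are separated by a step of the path, which lies on tile
-- boundaries, so no tile contains two consecutive ones; as tiles are rectangles, no tile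
-- contains two staircase cells at all. There are n tiles and n staircase cells, so every
-- tile contains exactly one. A tile containing a staircase cell satisfies
-- x₀ ≤ y₁ and y₀ < x₁, and two such tiles t, t' with t north-west of t' would give
-- x₁ t ≤ x₀ t' ≤ y₁ t' ≤ y₀ t < x₁ t.
module Submission where

open import Defs
open import Data.Nat using (ℕ; zero; suc; _+_; _∸_; _≤_; _<_; _≥_; s≤s; ⌊_/2⌋; ⌈_/2⌉)
open import Data.Nat.Properties
open import Data.Fin using (Fin; toℕ; punchOut)
open import Data.Fin.Properties using (any?; punchOut-injective; injective⇒≤; toℕ<n)
import Data.Fin.Properties as Fin
open import Data.Product using (_×_; _,_; proj₁; proj₂; ∃; Σ-syntax)
open import Data.Sum using (_⊎_; inj₁; inj₂)
open import Data.Empty using (⊥-elim)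
open import Function using (_∘_)
open import Function.Definitions using (Injective)
open import Relation.Binary.Definitions using (tri<; tri≈; tri>)
open import Relation.Nullary using (¬_; yes; no; contradiction)
open import Relation.Binary.PropositionalEquality

injective⇒surjective : ∀ {n} {f : Fin n → Fin n} → Injective _≡_ _≡_ f → ∀ i → ∃ λ k → f k ≡ i
injective⇒surjective {zero}      _     ()
injective⇒surjective {suc n} {f} f-inj i with any? (λ k → f k Fin.≟ i)
... | yes hit = hit
... | no miss = contradiction (injective⇒≤ g-inj) 1+n≰n
  where
  i≢f : ∀ k → i ≢ f k
  i≢f k i≡fk = miss (k , sym i≡fk)

  g : Fin (suc n) → Fin n
  g k = punchOut (i≢f k)

  g-inj : Injective _≡_ _≡_ g
  g-inj {k} {k′} = f-inj ∘ punchOut-injective (i≢f k) (i≢f k′)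

⌈n/2⌉≡⌊n/2⌋⊎⌈n/2⌉≡1+⌊n/2⌋ : ∀ n → ⌈ n /2⌉ ≡ ⌊ n /2⌋ ⊎ ⌈ n /2⌉ ≡ suc ⌊ n /2⌋
⌈n/2⌉≡⌊n/2⌋⊎⌈n/2⌉≡1+⌊n/2⌋ zero          = inj₁ refl
⌈n/2⌉≡⌊n/2⌋⊎⌈n/2⌉≡1+⌊n/2⌋ (suc zero)    = inj₂ refl
⌈n/2⌉≡⌊n/2⌋⊎⌈n/2⌉≡1+⌊n/2⌋ (suc (suc n)) with ⌈n/2⌉≡⌊n/2⌋⊎⌈n/2⌉≡1+⌊n/2⌋ n
... | inj₁ eq = inj₁ (cong suc eq)
... | inj₂ eq = inj₂ (cong suc eq)

⌈n/2⌉≤1+⌊n/2⌋ : ∀ n → ⌈ n /2⌉ ≤ suc ⌊ n /2⌋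
⌈n/2⌉≤1+⌊n/2⌋ n with ⌈n/2⌉≡⌊n/2⌋⊎⌈n/2⌉≡1+⌊n/2⌋ n
... | inj₁ eq = ≤-trans (≤-reflexive eq) (n≤1+n _)
... | inj₂ eq = ≤-reflexive eq

private
  variable
    T T′ : Tile
    a a′ a″ b b′ b″ k k′ : ℕ

covers-convex : Covers T a b → Covers T a′ b′ →
                a ≤ a″ → a″ ≤ a′ → b ≤ b″ → b″ ≤ b′ → Covers T a″ b″
covers-convex (x₀≤a , _ , y₀≤b , _) (_ , a′<x₁ , _ , b′<y₁) a≤a″ a″≤a′ b≤b″ b″≤b′ =
  ≤-trans x₀≤a a≤a″ , ≤-<-trans a″≤a′ a′<x₁ , ≤-trans y₀≤b b≤b″ , ≤-<-trans b″≤b′ b′<y₁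

CoversStair : Tile → ℕ → Set
CoversStair T k = Covers T ⌈ k /2⌉ ⌊ k /2⌋

coversStair⇒x₀≤y₁ : CoversStair T k → x₀ T ≤ y₁ T
coversStair⇒x₀≤y₁ {k = k} (x₀≤c , _ , _ , d<y₁) = ≤-trans x₀≤c (≤-trans (⌈n/2⌉≤1+⌊n/2⌋ k) d<y₁)

coversStair⇒y₀<x₁ : CoversStair T k → y₀ T < x₁ T
coversStair⇒y₀<x₁ {k = k} (_ , c<x₁ , y₀≤d , _) = ≤-<-trans y₀≤d (≤-<-trans (⌊n/2⌋≤⌈n/2⌉ k) c<x₁)

_IsNorthWestOf_ : Tile → Tile → Set
T IsNorthWestOf T′ = x₁ T ≤ x₀ T′ × y₀ T ≥ y₁ T′

coversStair⇒¬IsNorthWestOf : CoversStair T k → CoversStair T′ k′ → ¬ T IsNorthWestOf T′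
coversStair⇒¬IsNorthWestOf {T} {T′ = T′} c c′ (x₁≤x₀′ , y₁′≤y₀) = n≮n (x₁ T) (begin-strict
  x₁ T  ≤⟨ x₁≤x₀′ ⟩
  x₀ T′ ≤⟨ coversStair⇒x₀≤y₁ c′ ⟩
  y₁ T′ ≤⟨ y₁′≤y₀ ⟩
  y₀ T  <⟨ coversStair⇒y₀<x₁ c ⟩
  x₁ T  ∎)
  where open ≤-Reasoning

module Floorplan {W H m : ℕ} {t : Fin m → Tile} (plan : IsFloorplan W H m t) where

  y₀<y₁ : ∀ i → y₀ (t i) < y₁ (t i)
  y₀<y₁ i = proj₁ (proj₂ (proj₁ plan i))

  x₀<x₁ : ∀ i → x₀ (t i) < x₁ (t i)
  x₀<x₁ i = proj₁ (proj₁ plan i)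

  covers⇒<W : ∀ i → Covers (t i) a b → a < W
  covers⇒<W i (_ , a<x₁ , _) = <-≤-trans a<x₁ (proj₁ (proj₂ (proj₂ (proj₁ plan i))))

  covers⇒<H : ∀ i → Covers (t i) a b → b < H
  covers⇒<H i (_ , _ , _ , b<y₁) = <-≤-trans b<y₁ (proj₂ (proj₂ (proj₂ (proj₁ plan i))))

  cellTile : a < W → b < H → ∃ λ i → Covers (t i) a b
  cellTile = proj₁ (proj₂ plan) _ _

  coveringTile-unique : ∀ i j → Covers (t i) a b → Covers (t j) a b → i ≡ j
  coveringTile-unique = proj₂ (proj₂ plan) _ _

  hBoundary-separates : ∀ i → Covers (t i) a b → Covers (t i) a (suc b) → ¬ OnHSeg t a (suc b)
  hBoundary-separates i below@(_ , _ , y₀≤b , _) above (j , inj₁ y₀≡ , x₀≤a , a<x₁) =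
    <-irrefl (trans (cong (y₀ ∘ t) i≡j) y₀≡) (s≤s y₀≤b)
    where
    i≡j = coveringTile-unique i j above
            (x₀≤a , a<x₁ , ≤-reflexive y₀≡ , subst (_< y₁ (t j)) y₀≡ (y₀<y₁ j))
  hBoundary-separates i below (_ , _ , _ , b<y₁) (j , inj₂ y₁≡ , x₀≤a , a<x₁) =
    <-irrefl (sym (trans (cong (y₁ ∘ t) i≡j) y₁≡)) b<y₁
    where
    i≡j = coveringTile-unique i j below
            (x₀≤a , a<x₁ , ≤-pred (subst (y₀ (t j) <_) y₁≡ (y₀<y₁ j)) , ≤-reflexive (sym y₁≡))

  vBoundary-separates : ∀ i → Covers (t i) a b → Covers (t i) (suc a) b → ¬ OnVSeg t (suc a) b
  vBoundary-separates i left@(x₀≤a , _) right (j , inj₁ x₀≡ , y₀≤b , b<y₁) =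
    <-irrefl (trans (cong (x₀ ∘ t) i≡j) x₀≡) (s≤s x₀≤a)
    where
    i≡j = coveringTile-unique i j right
            (≤-reflexive x₀≡ , subst (_< x₁ (t j)) x₀≡ (x₀<x₁ j) , y₀≤b , b<y₁)
  vBoundary-separates i left (_ , a<x₁ , _) (j , inj₂ x₁≡ , y₀≤b , b<y₁) =
    <-irrefl (sym (trans (cong (x₁ ∘ t) i≡j) x₁≡)) a<x₁
    where
    i≡j = coveringTile-unique i j left
            (≤-pred (subst (x₀ (t j) <_) x₁≡ (x₀<x₁ j)) , ≤-reflexive (sym x₁≡) , y₀≤b , b<y₁)

module Alternating {n : ℕ} {t : Fin n → Tile} (alt : IsAlternating n t) where

  open Floorplan (proj₁ alt)

  -- Cell k + 1 is (1 + ⌊k/2⌋, ⌈k/2⌉), so it lies east of cell k when k is even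
  -- and north of it when k is odd.
  ¬coversStair-consecutive : ∀ i k → CoversStair (t i) k → ¬ CoversStair (t i) (suc k)
  ¬coversStair-consecutive i k here next with ⌈n/2⌉≡⌊n/2⌋⊎⌈n/2⌉≡1+⌊n/2⌋ k
  ... | inj₁ c≡d = vBoundary-separates i here′ next′ (proj₂ (proj₂ alt) _ (covers⇒<H i here′))
    where
    here′  = subst (λ c → Covers (t i) c ⌊ k /2⌋) c≡d here
    next′  = subst (Covers (t i) (suc ⌊ k /2⌋)) c≡d next
  ... | inj₂ c≡1+d = hBoundary-separates i here′ next′ (proj₁ (proj₂ alt) _ (covers⇒<W i here′))
    where
    here′  = subst (λ c → Covers (t i) c ⌊ k /2⌋) c≡1+d here
    next′  = subst (Covers (t i) (suc ⌊ k /2⌋)) c≡1+d next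

  ¬coversStair-two : ∀ i → k < k′ → CoversStair (t i) k → ¬ CoversStair (t i) k′
  ¬coversStair-two {k} i k<k′ here there = ¬coversStair-consecutive i k here
    (covers-convex here there (⌈n/2⌉-mono (n≤1+n k)) (⌈n/2⌉-mono k<k′)
                              (⌊n/2⌋-mono (n≤1+n k)) (⌊n/2⌋-mono k<k′))

  stairTile : Fin n → Fin n
  stairTile k = proj₁ (cellTile (⌈n/2⌉-mono (s≤s (toℕ<n k))) (⌊n/2⌋-mono (s≤s (toℕ<n k))))

  stairTile-covers : ∀ k → CoversStair (t (stairTile k)) (toℕ k)
  stairTile-covers k = proj₂ (cellTile (⌈n/2⌉-mono (s≤s (toℕ<n k))) (⌊n/2⌋-mono (s≤s (toℕ<n k))))

  stairTile-injective : Injective _≡_ _≡_ stairTile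
  stairTile-injective {k} {k′} same with Fin.<-cmp k k′
  ... | tri< k<k′ _ _ = ⊥-elim (¬coversStair-two (stairTile k′) k<k′
                          (subst (λ i → CoversStair (t i) (toℕ k)) same (stairTile-covers k))
                          (stairTile-covers k′))
  ... | tri≈ _ k≡k′ _ = k≡k′
  ... | tri> _ _ k>k′ = ⊥-elim (¬coversStair-two (stairTile k) k>k′
                          (subst (λ i → CoversStair (t i) (toℕ k′)) (sym same) (stairTile-covers k′))
                          (stairTile-covers k))

  coversStair : ∀ i → ∃ λ k → CoversStair (t i) k
  coversStair i with injective⇒surjective stairTile-injective i
  ... | k , refl = toℕ k , stairTile-covers k

  ¬northWestPair : ¬ (Σ[ i ∈ Fin n ] Σ[ j ∈ Fin n ] t i IsNorthWestOf t j)
  ¬northWestPair (i , j , nw) =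
    coversStair⇒¬IsNorthWestOf (proj₂ (coversStair i)) (proj₂ (coversStair j)) nw

lemma6p7 : (n : ℕ) → 1 ≤ n → (t : Fin n → Tile) → IsAlternating n t → IsPacked (aheight n) (awidth n) n t
lemma6p7 n _ t alt = proj₁ alt , tileCount , Alternating.¬northWestPair alt
  where
  tileCount : n ≡ aheight n + awidth n ∸ 1
  tileCount = sym (cong (_∸ 1) (⌊n/2⌋+⌈n/2⌉≡n (suc n)))
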